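{- Let $E=\{0,1,\dots,n\}$, let $M$ be a loopless matroid of rank $r+1$ on $E$, and let $1\le k\le n$. Then in $A^1(M)$, \[\gamma_k=(n+1-k)\gamma_n-\sum_{F:\,|F|\ge k+1}(|F|-k)\,x_F,\] where the sum ranges over nonempty proper flats $F$ of $M$ with $|F|\ge k+1$.
   Context: The Chow ring $A^*(M)$ (real coefficients) is $\mathbb{R}[x_F : F \text{ a nonempty proper flat of } M]$ modulo the ideal generated by all $x_{F_1}x_{F_2}$ with $F_1,F_2$ incomparable and all $\sum_{F\ni i}x_F-\sum_{F\ni j}x_F$ for $i,j\in E$. For $S\subseteq E$, $x_S$ means the generator if $S$ is a nonempty proper flat and $0$ otherwise. For a finite set $U$, $S\subseteq U$ and an integer $k$, let $\mathrm{mult}_U(|S|,k)=\min(|S|,k)-\frac{k}{|U|}|S|$. For $1\le k\le n$ the hypersimplex class is $\gamma_k=\sum_{S}\mathrm{mult}_E(|S|,k)x_S\in A^1(M)$, the sum over nonempty proper subsets $S\subsetneq E$. -}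

module Defs where

open import Data.Nat as ℕ using (ℕ; zero; suc; _⊓_; _≤_; _<_)
open import Data.Nat.Properties using (_≤?_; _<?_)
open import Data.Integer as ℤ using (ℤ; +_)
open import Data.Rational as ℚ using (ℚ; _/_)
open import Data.Bool using (Bool; true; false; T; _∧_; _∨_; not; if_then_else_)
open import Data.Unit using (tt)
open import Data.Fin using (Fin)
open import Data.Fin.Subset using (Subset; _⊆_; _∪_; _∩_; ⁅_⁆; ∣_∣; ⊥; ⊤)
open import Data.Vec using (Vec; []; _∷_; lookup)
open import Data.List using (List; []; _∷_; _++_; map; allFin; foldr)
open import Data.Product using (Σ; _,_; proj₁; _×_)
open import Relation.Nullary using (¬_)
open import Relation.Nullary.Decidable using (⌊_⌋)
open import Relation.Binary.PropositionalEquality using (_≡_)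

record Matroid (m : ℕ) : Set where
  field
    rk         : Subset m → ℕ
    rk-≤-card  : ∀ X → rk X ≤ ∣ X ∣
    rk-mono    : ∀ X Y → X ⊆ Y → rk X ≤ rk Y
    rk-submod  : ∀ X Y → rk (X ∪ Y) ℕ.+ rk (X ∩ Y) ≤ rk X ℕ.+ rk Y
open Matroid public

Loopless : ∀ {m} → Matroid m → Set
Loopless {m} M = ∀ (e : Fin m) → rk M ⁅ e ⁆ ≡ 1

rankM : ∀ {m} → Matroid m → ℕ
rankM M = rk M ⊤

allSubsets : (m : ℕ) → List (Subset m)
allSubsets zero = [] ∷ []
allSubsets (suc m) = map (true ∷_) (allSubsets m) ++ map (false ∷_) (allSubsets m)

isFlat : ∀ {m} → Matroid m → Subset m → Bool
isFlat {m} M S =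
  foldr _∧_ true (map (λ e → lookup S e ∨ ⌊ rk M S <? rk M (S ∪ ⁅ e ⁆) ⌋) (allFin m))

isNonemptyProper : ∀ {m} → Subset m → Bool
isNonemptyProper {m} S = ⌊ 1 ≤? ∣ S ∣ ⌋ ∧ ⌊ ∣ S ∣ <? m ⌋

isNPFlat : ∀ {m} → Matroid m → Subset m → Bool
isNPFlat M S = isNonemptyProper S ∧ isFlat M S

NPFlat : ∀ {m} → Matroid m → Set
NPFlat {m} M = Σ (Subset m) (λ F → T (isNPFlat M F))

infixl 6 _⊕_
infixl 7 _⊗_

data Expr (V : Set) : Set where
  var  : V → Expr V
  con  : ℚ → Expr V
  _⊕_  : Expr V → Expr V → Expr V
  _⊗_  : Expr V → Expr V → Expr V
  neg  : Expr V → Expr V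

ΣE : ∀ {V A : Set} → List A → (A → Expr V) → Expr V
ΣE xs f = foldr (λ a acc → f a ⊕ acc) (con ℚ.0ℚ) xs

-- Chow ring A*(M) ⊗ ℚ presented as a setoid: polynomial expressions in
-- the x_F modulo the congruence generated by the commutative ℚ-algebra
-- laws and the defining relations of the Chow ring.

module Chow {m : ℕ} (M : Matroid m) where

  V = NPFlat M
  A = Expr V

  mkVar : (b : Bool) → (T b → V) → A
  mkVar true f = var (f tt)
  mkVar false _ = con ℚ.0ℚ

  -- x_S : the generator if S is a nonempty proper flat, 0 otherwise
  x : Subset m → A
  x S = mkVar (isNPFlat M S) (λ p → S , p)

  linForm : Fin m → A
  linForm i = ΣE (allSubsets m) (λ S → if lookup S i then x S else con ℚ.0ℚ)

  Incomparable : Subset m → Subset m → Set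
  Incomparable F G = ¬ (F ⊆ G) × ¬ (G ⊆ F)

  infix 4 _≈_
  data _≈_ : A → A → Set where
    ≈-refl  : ∀ {a} → a ≈ a
    ≈-sym   : ∀ {a b} → a ≈ b → b ≈ a
    ≈-trans : ∀ {a b c} → a ≈ b → b ≈ c → a ≈ c
    ⊕-cong  : ∀ {a b c d} → a ≈ b → c ≈ d → a ⊕ c ≈ b ⊕ d
    ⊗-cong  : ∀ {a b c d} → a ≈ b → c ≈ d → a ⊗ c ≈ b ⊗ d
    neg-cong : ∀ {a b} → a ≈ b → neg a ≈ neg b
    ⊕-assoc : ∀ a b c → (a ⊕ b) ⊕ c ≈ a ⊕ (b ⊕ c)
    ⊕-comm  : ∀ a b → a ⊕ b ≈ b ⊕ a
    ⊕-idˡ   : ∀ a → con ℚ.0ℚ ⊕ a ≈ a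
    neg-invˡ : ∀ a → neg a ⊕ a ≈ con ℚ.0ℚ
    ⊗-assoc : ∀ a b c → (a ⊗ b) ⊗ c ≈ a ⊗ (b ⊗ c)
    ⊗-comm  : ∀ a b → a ⊗ b ≈ b ⊗ a
    ⊗-idˡ   : ∀ a → con ℚ.1ℚ ⊗ a ≈ a
    distribˡ : ∀ a b c → a ⊗ (b ⊕ c) ≈ (a ⊗ b) ⊕ (a ⊗ c)
    con-+   : ∀ p q → con p ⊕ con q ≈ con (p ℚ.+ q)
    con-*   : ∀ p q → con p ⊗ con q ≈ con (p ℚ.* q)
    con-neg : ∀ p → neg (con p) ≈ con (ℚ.- p)
    incomp  : ∀ (F G : V) → Incomparable (proj₁ F) (proj₁ G) →
              var F ⊗ var G ≈ con ℚ.0ℚ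
    linear  : ∀ (i j : Fin m) → linForm i ≈ linForm j

ℕ→ℚ : ℕ → ℚ
ℕ→ℚ a = (+ a) / 1

-- mult_U(s, k) = min(s,k) - (k/|U|) s, for |U| = suc u
mult : (u s k : ℕ) → ℚ
mult u s k = ℕ→ℚ (s ⊓ k) ℚ.- ((+ (k ℕ.* s)) / suc u)

module Hyper {n : ℕ} (M : Matroid (suc n)) where
  open Chow M public

  γ : ℕ → A
  γ k = ΣE (allSubsets (suc n))
          (λ S → if isNonemptyProper S
                   then con (mult n ∣ S ∣ k) ⊗ x S
                   else con ℚ.0ℚ)

  tailSum : ℕ → A
  tailSum k = ΣE (allSubsets (suc n))
          (λ S → if isNPFlat M S ∧ ⌊ suc k ≤? ∣ S ∣ ⌋
                   then con (ℕ→ℚ ∣ S ∣ ℚ.- ℕ→ℚ k) ⊗ x S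
                   else con ℚ.0ℚ)

-- The identity holds coefficientwise, before any relation of the Chow ring is
-- used. With s = |S| one has mult_E(s, n) = s/(n+1), so (n+1-k) mult_E(s, n)
-- = s - ks/(n+1), which differs from mult_E(s, k) = min(s, k) - ks/(n+1) by
-- s - min(s, k): that is |S| - k when |S| > k and 0 otherwise. Subsets that
-- are not flats contribute nothing to either side since x_S = 0.

module Submission where

open import Defs
open import Data.Nat using (ℕ; suc; _≤_)
open import Data.Rational using (_-_)
open import Relation.Binary.PropositionalEquality using (_≡_)

open import Level using (0ℓ)
open import Algebra.Bundles using (CommutativeRing)
open import Algebra.Structures using (IsCommutativeRing)
import Algebra.Consequences.Setoid as Consequences
import Algebra.Properties.AbelianGroup as AbelianGroupProperties
import Algebra.Properties.CommutativeSemigroup as CommutativeSemigroupProperties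
import Algebra.Properties.Ring as RingProperties
open import Data.Bool using (Bool; true; false; T; _∧_; if_then_else_)
open import Data.Bool.Properties using (T-∧)
open import Data.Fin.Subset using (Subset; ∣_∣)
open import Data.Integer as ℤ using (+_)
import Data.Integer.Properties as ℤ
open import Data.Integer.Tactic.RingSolver using (solve-∀)
open import Data.List using (List; []; _∷_)
import Data.Nat as ℕ
import Data.Nat.Properties as ℕ
open import Data.Product using (_,_; proj₂)
open import Data.Rational as ℚ using (ℚ; _/_; toℚᵘ)
import Data.Rational.Properties as ℚ
open import Data.Rational.Solver using (module +-*-Solver)
open import Data.Rational.Unnormalised as ℚᵘ using (mkℚᵘ; *≡*)
import Data.Rational.Unnormalised.Properties as ℚᵘ
open import Data.Unit using (tt)
open import Function.Bundles using (Equivalence)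
open import Relation.Binary.Bundles using (Setoid)
open import Relation.Binary.PropositionalEquality
  using (refl; sym; trans; cong; cong₂; module ≡-Reasoning)
open import Relation.Nullary using (yes; no)
open import Relation.Nullary.Decidable using (⌊_⌋; toWitness)

-- i / suc d unfolds to fromℚᵘ (mkℚᵘ i d).
toℚᵘ-/ : ∀ i d → toℚᵘ (i / suc d) ℚᵘ.≃ mkℚᵘ i d
toℚᵘ-/ i d = ℚ.toℚᵘ-fromℚᵘ (mkℚᵘ i d)

ℕ→ℚ-homo-+ : ∀ a b → ℕ→ℚ (a ℕ.+ b) ≡ ℕ→ℚ a ℚ.+ ℕ→ℚ b
ℕ→ℚ-homo-+ a b = ℚ.toℚᵘ-injective (begin
  toℚᵘ (ℕ→ℚ (a ℕ.+ b))            ≈⟨ toℚᵘ-/ (+ (a ℕ.+ b)) 0 ⟩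
  mkℚᵘ (+ (a ℕ.+ b)) 0             ≈⟨ *≡* (trans (cong (ℤ._* + 1) (ℤ.pos-+ a b)) (+-over-1 (+ a) (+ b))) ⟩
  mkℚᵘ (+ a) 0 ℚᵘ.+ mkℚᵘ (+ b) 0   ≈⟨ ℚᵘ.+-cong (toℚᵘ-/ (+ a) 0) (toℚᵘ-/ (+ b) 0) ⟨
  toℚᵘ (ℕ→ℚ a) ℚᵘ.+ toℚᵘ (ℕ→ℚ b)   ≈⟨ ℚ.toℚᵘ-homo-+ (ℕ→ℚ a) (ℕ→ℚ b) ⟨
  toℚᵘ (ℕ→ℚ a ℚ.+ ℕ→ℚ b)           ∎)
  where
  open ℚᵘ.≃-Reasoning
  +-over-1 : ∀ i j → (i ℤ.+ j) ℤ.* + 1 ≡ (i ℤ.* + 1 ℤ.+ j ℤ.* + 1) ℤ.* + 1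
  +-over-1 = solve-∀

ℕ→ℚ-*-/ : ∀ a b d → ℕ→ℚ a ℚ.* (+ b / suc d) ≡ + (a ℕ.* b) / suc d
ℕ→ℚ-*-/ a b d = ℚ.toℚᵘ-injective (begin
  toℚᵘ (ℕ→ℚ a ℚ.* (+ b / suc d))        ≈⟨ ℚ.toℚᵘ-homo-* (ℕ→ℚ a) (+ b / suc d) ⟩
  toℚᵘ (ℕ→ℚ a) ℚᵘ.* toℚᵘ (+ b / suc d)  ≈⟨ ℚᵘ.*-cong (toℚᵘ-/ (+ a) 0) (toℚᵘ-/ (+ b) d) ⟩
  mkℚᵘ (+ a) 0 ℚᵘ.* mkℚᵘ (+ b) d        ≈⟨ *≡* (cong₂ ℤ._*_ (sym (ℤ.pos-* a b)) (cong +_ (sym (ℕ.*-identityˡ (suc d))))) ⟩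
  mkℚᵘ (+ (a ℕ.* b)) d                  ≈⟨ toℚᵘ-/ (+ (a ℕ.* b)) d ⟨
  toℚᵘ (+ (a ℕ.* b) / suc d)            ∎)
  where open ℚᵘ.≃-Reasoning

ℕ→ℚ-*-/-cancel : ∀ b d → ℕ→ℚ (suc d) ℚ.* (+ b / suc d) ≡ ℕ→ℚ b
ℕ→ℚ-*-/-cancel b d = ℚ.toℚᵘ-injective (begin
  toℚᵘ (ℕ→ℚ (suc d) ℚ.* (+ b / suc d))        ≈⟨ ℚ.toℚᵘ-homo-* (ℕ→ℚ (suc d)) (+ b / suc d) ⟩
  toℚᵘ (ℕ→ℚ (suc d)) ℚᵘ.* toℚᵘ (+ b / suc d)  ≈⟨ ℚᵘ.*-cong (toℚᵘ-/ (+ suc d) 0) (toℚᵘ-/ (+ b) d) ⟩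
  mkℚᵘ (+ suc d) 0 ℚᵘ.* mkℚᵘ (+ b) d          ≈⟨ *≡* cross-multiplied ⟩
  mkℚᵘ (+ b) 0                                ≈⟨ toℚᵘ-/ (+ b) 0 ⟨
  toℚᵘ (ℕ→ℚ b)                                ∎)
  where
  open ℚᵘ.≃-Reasoning
  cross-multiplied : (+ suc d ℤ.* + b) ℤ.* + 1 ≡ + b ℤ.* + (1 ℕ.* suc d)
  cross-multiplied = trans (ℤ.*-identityʳ _) (trans (ℤ.*-comm (+ suc d) (+ b))
    (cong (λ e → + b ℤ.* + e) (sym (ℕ.*-identityˡ (suc d)))))

mult-self : ∀ {n s} → s ≤ n → mult n s n ≡ + s / suc n
mult-self {n} {s} s≤n = begin
  mult n s n                              ≡⟨ cong₂ _-_ (cong ℕ→ℚ (ℕ.m≤n⇒m⊓n≡m s≤n)) (sym (ℕ→ℚ-*-/ n s n)) ⟩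
  ℕ→ℚ s - ℕ→ℚ n ℚ.* w                     ≡⟨ cong (λ t → t - ℕ→ℚ n ℚ.* w) (sym (ℕ→ℚ-*-/-cancel s n)) ⟩
  ℕ→ℚ (suc n) ℚ.* w - ℕ→ℚ n ℚ.* w         ≡⟨ cong (λ t → t ℚ.* w - ℕ→ℚ n ℚ.* w) (ℕ→ℚ-homo-+ 1 n) ⟩
  (ℚ.1ℚ ℚ.+ ℕ→ℚ n) ℚ.* w - ℕ→ℚ n ℚ.* w    ≡⟨ solve 2 (λ N w → (con ℚ.1ℚ :+ N) :* w :- N :* w := w) refl (ℕ→ℚ n) w ⟩
  w                                       ∎
  where
  open ≡-Reasoning
  open +-*-Solver
  w : ℚ
  w = + s / suc n

mult-decomposition : ∀ {n s} k → s ≤ n →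
  mult n s k ≡ (ℕ→ℚ (suc n) - ℕ→ℚ k) ℚ.* mult n s n - (ℕ→ℚ s - ℕ→ℚ (s ℕ.⊓ k))
mult-decomposition {n} {s} k s≤n = begin
  mult n s k                           ≡⟨ cong (μ -_) (sym (ℕ→ℚ-*-/ k s n)) ⟩
  μ - K ℚ.* w                          ≡⟨ solve 4 (λ μ K N w → μ :- K :* w := (N :- K) :* w :- (N :* w :- μ)) refl μ K N w ⟩
  (N - K) ℚ.* w - (N ℚ.* w - μ)        ≡⟨ cong₂ (λ t u → (N - K) ℚ.* t - (u - μ)) (sym (mult-self s≤n)) (ℕ→ℚ-*-/-cancel s n) ⟩
  (N - K) ℚ.* mult n s n - (ℕ→ℚ s - μ) ∎
  where
  open ≡-Reasoning
  open +-*-Solver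
  μ K N w : ℚ
  μ = ℕ→ℚ (s ℕ.⊓ k)
  K = ℕ→ℚ k
  N = ℕ→ℚ (suc n)
  w = + s / suc n

module ChowAlgebra {m : ℕ} (M : Matroid m) where
  open Chow M

  ≈-setoid : Setoid 0ℓ 0ℓ
  ≈-setoid = record
    { Carrier = A
    ; _≈_ = _≈_
    ; isEquivalence = record { refl = ≈-refl ; sym = ≈-sym ; trans = ≈-trans }
    }

  open Consequences ≈-setoid using (comm∧idˡ⇒id; comm∧invˡ⇒inv; comm∧distrˡ⇒distr)

  isCommutativeRing : IsCommutativeRing _≈_ _⊕_ _⊗_ neg (con ℚ.0ℚ) (con ℚ.1ℚ)
  isCommutativeRing = record
    { isRing = record
      { +-isAbelianGroup = record
        { isGroup = record
          { isMonoid = record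
            { isSemigroup = record
              { isMagma = record
                { isEquivalence = Setoid.isEquivalence ≈-setoid
                ; ∙-cong = ⊕-cong
                }
              ; assoc = ⊕-assoc
              }
            ; identity = comm∧idˡ⇒id ⊕-comm ⊕-idˡ
            }
          ; inverse = comm∧invˡ⇒inv ⊕-comm neg-invˡ
          ; ⁻¹-cong = neg-cong
          }
        ; comm = ⊕-comm
        }
      ; *-cong = ⊗-cong
      ; *-assoc = ⊗-assoc
      ; *-identity = comm∧idˡ⇒id ⊗-comm ⊗-idˡ
      ; distrib = comm∧distrˡ⇒distr ⊕-cong ⊗-comm distribˡ
      }
    ; *-comm = ⊗-comm
    }

  commutativeRing : CommutativeRing 0ℓ 0ℓ
  commutativeRing = record { isCommutativeRing = isCommutativeRing }

  open CommutativeRing commutativeRing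
    using (zeroʳ; +-commutativeSemigroup; +-abelianGroup; ring)
  open CommutativeSemigroupProperties +-commutativeSemigroup using (interchange)
  open AbelianGroupProperties +-abelianGroup using (⁻¹-∙-comm)
  open RingProperties ring using (-0#≈0#; -‿distribˡ-*)
  open import Relation.Binary.Reasoning.Setoid ≈-setoid

  0≈c*0-0 : ∀ c → con ℚ.0ℚ ≈ c ⊗ con ℚ.0ℚ ⊕ neg (con ℚ.0ℚ)
  0≈c*0-0 c = ≈-sym (≈-trans (⊕-cong (zeroʳ c) -0#≈0#) (⊕-idˡ (con ℚ.0ℚ)))

  ΣE-linear : ∀ {B : Set} (xs : List B) (c : A) (f g h : B → A) →
    (∀ b → f b ≈ c ⊗ g b ⊕ neg (h b)) →
    ΣE xs f ≈ c ⊗ ΣE xs g ⊕ neg (ΣE xs h)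
  ΣE-linear [] c f g h _ = 0≈c*0-0 c
  ΣE-linear (b ∷ xs) c f g h f≈cg-h = begin
    f b ⊕ ΣE xs f                                              ≈⟨ ⊕-cong (f≈cg-h b) (ΣE-linear xs c f g h f≈cg-h) ⟩
    (c ⊗ g b ⊕ neg (h b)) ⊕ (c ⊗ ΣE xs g ⊕ neg (ΣE xs h))     ≈⟨ interchange _ _ _ _ ⟩
    (c ⊗ g b ⊕ c ⊗ ΣE xs g) ⊕ (neg (h b) ⊕ neg (ΣE xs h))     ≈⟨ ⊕-cong (≈-sym (distribˡ c (g b) (ΣE xs g))) (⁻¹-∙-comm (h b) (ΣE xs h)) ⟩
    c ⊗ (g b ⊕ ΣE xs g) ⊕ neg (h b ⊕ ΣE xs h)                 ∎

  con-affine : ∀ c q e v →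
    con c ⊗ (con q ⊗ v) ⊕ neg (con e ⊗ v) ≈ con (c ℚ.* q - e) ⊗ v
  con-affine c q e v = begin
    con c ⊗ (con q ⊗ v) ⊕ neg (con e ⊗ v)       ≈⟨ ⊕-cong (≈-sym (⊗-assoc (con c) (con q) v)) (-‿distribˡ-* (con e) v) ⟩
    (con c ⊗ con q) ⊗ v ⊕ neg (con e) ⊗ v       ≈⟨ ⊕-cong (⊗-cong (con-* c q) ≈-refl) (⊗-cong (con-neg e) ≈-refl) ⟩
    con (c ℚ.* q) ⊗ v ⊕ con (ℚ.- e) ⊗ v         ≈⟨ ⊕-cong (⊗-comm _ v) (⊗-comm _ v) ⟩
    v ⊗ con (c ℚ.* q) ⊕ v ⊗ con (ℚ.- e)         ≈⟨ distribˡ v _ _ ⟨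
    v ⊗ (con (c ℚ.* q) ⊕ con (ℚ.- e))           ≈⟨ ⊗-cong ≈-refl (con-+ _ _) ⟩
    v ⊗ con (c ℚ.* q - e)                       ≈⟨ ⊗-comm v _ ⟩
    con (c ℚ.* q - e) ⊗ v                       ∎

nonemptyProper⇒∣S∣≤n : ∀ {n} (S : Subset (suc n)) → T (isNonemptyProper S) → ∣ S ∣ ≤ n
nonemptyProper⇒∣S∣≤n {n} S np =
  ℕ.s≤s⁻¹ (toWitness (proj₂ (Equivalence.to (T-∧ {⌊ 1 ℕ.≤? ∣ S ∣ ⌋} {⌊ ∣ S ∣ ℕ.<? suc n ⌋}) np)))

module HypersimplexSummands {n : ℕ} (M : Matroid (suc n)) (k : ℕ) where
  open Hyper M
  open ChowAlgebra M
  open CommutativeRing commutativeRing using (reflexive; zeroˡ; zeroʳ)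
  open import Relation.Binary.Reasoning.Setoid ≈-setoid

  -- The summands of γ j and tailSum k at S, abstracted over the booleans and
  -- over x S so that the conditionals reduce under case analysis.
  γ-term : ℕ → Bool → ℕ → A → A
  γ-term j np s v = if np then con (mult n s j) ⊗ v else con ℚ.0ℚ

  tail-term : Bool → ℕ → A → A
  tail-term b s v = if b ∧ ⌊ suc k ℕ.≤? s ⌋ then con (ℕ→ℚ s - ℕ→ℚ k) ⊗ v else con ℚ.0ℚ

  tail-term-coefficient : ∀ fl (f : T fl → V) s →
    con (ℕ→ℚ s - ℕ→ℚ (s ℕ.⊓ k)) ⊗ mkVar fl f ≈ tail-term fl s (mkVar fl f)
  tail-term-coefficient false f s = zeroʳ _
  tail-term-coefficient true f s with suc k ℕ.≤? s
  ... | yes k<s = reflexive (cong (λ t → con (ℕ→ℚ s - ℕ→ℚ t) ⊗ var (f tt)) (ℕ.m≥n⇒m⊓n≡n (ℕ.<⇒≤ k<s)))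
  ... | no k≮s = begin
    con (ℕ→ℚ s - ℕ→ℚ (s ℕ.⊓ k)) ⊗ var (f tt)  ≡⟨ cong (λ t → con (ℕ→ℚ s - ℕ→ℚ t) ⊗ var (f tt)) (ℕ.m≤n⇒m⊓n≡m (ℕ.≮⇒≥ k≮s)) ⟩
    con (ℕ→ℚ s - ℕ→ℚ s) ⊗ var (f tt)          ≡⟨ cong (λ q → con q ⊗ var (f tt)) (ℚ.+-inverseʳ (ℕ→ℚ s)) ⟩
    con ℚ.0ℚ ⊗ var (f tt)                      ≈⟨ zeroˡ _ ⟩
    con ℚ.0ℚ                                   ∎

  summand-identity : ∀ np fl (f : T (np ∧ fl) → V) s → (T np → s ≤ n) →
    let c = ℕ→ℚ (suc n) - ℕ→ℚ k ; v = mkVar (np ∧ fl) f in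
    γ-term k np s v ≈ con c ⊗ γ-term n np s v ⊕ neg (tail-term (np ∧ fl) s v)
  summand-identity false fl f s _ = 0≈c*0-0 _
  summand-identity true fl f s s≤n = begin
    con (mult n s k) ⊗ v                                   ≡⟨ cong (λ q → con q ⊗ v) (mult-decomposition k (s≤n tt)) ⟩
    con (c ℚ.* mult n s n - e) ⊗ v                         ≈⟨ con-affine c (mult n s n) e v ⟨
    con c ⊗ (con (mult n s n) ⊗ v) ⊕ neg (con e ⊗ v)       ≈⟨ ⊕-cong ≈-refl (neg-cong (tail-term-coefficient fl f s)) ⟩
    con c ⊗ (con (mult n s n) ⊗ v) ⊕ neg (tail-term fl s v) ∎
    where
    c e : ℚ
    c = ℕ→ℚ (suc n) - ℕ→ℚ k
    e = ℕ→ℚ s - ℕ→ℚ (s ℕ.⊓ k)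
    v : A
    v = mkVar fl f

lemma2p4 : (n r : ℕ) (M : Matroid (suc n)) → Loopless M → rankM M ≡ suc r →
    (k : ℕ) → 1 ≤ k → k ≤ n →
    let open Hyper M in
    γ k ≈ (con (ℕ→ℚ (suc n) - ℕ→ℚ k) ⊗ γ n) ⊕ neg (tailSum k)
lemma2p4 n r M _ _ k _ _ = ΣE-linear (allSubsets (suc n)) _ _ _ _ λ S →
  summand-identity (isNonemptyProper S) (isFlat M S) (λ p → S , p) ∣ S ∣ (nonemptyProper⇒∣S∣≤n S)
  where
  open ChowAlgebra M
  open HypersimplexSummands M k
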